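{- Let $q,n\in\mathbb{N}$, let $h,k\in\mathbb{N}_0$, and suppose that $h\leq k<q$. Then any $k$-crystal in $\mathcal{T}^{n\cdot\mathbf{1}_q}(\mathbb{Z})$ is also an $h$-crystal.
   Context: $\mathbb{N}_0=\mathbb{N}\cup\{0\}$. $\mathcal{T}^{n\cdot\mathbf{1}_q}(\mathbb{Z})$ is the set of functions $C:[n]^q\to\mathbb{Z}$, $[n]=\{1,\dots,n\}$. For $\mathbf{b}=(b_1,\dots,b_q)$ and $\mathbf{i}=(i_1,\dots,i_r)\in[q]^r$, $\mathbf{b}_{\mathbf{i}}=(b_{i_1},\dots,b_{i_r})$ (the empty tuple if $r=0$; $[n]^0$ consists of the empty tuple). The projection $\Pi_{\mathbf{i}}*C:[n]^r\to\mathbb{Z}$ is $(\Pi_{\mathbf{i}}*C)(\mathbf{a})=\sum_{\mathbf{b}\in[n]^q,\ \mathbf{b}_{\mathbf{i}}=\mathbf{a}}C(\mathbf{b})$. $[q]^r_\to$ denotes the set of strictly increasing tuples in $[q]^r$ ($[q]^0_\to$ consists of the empty tuple). For $r\in\{0,\dots,q\}$, $C$ is an $r$-crystal if $\Pi_{\mathbf{i}}*C=\Pi_{\mathbf{j}}*C$ for all $\mathbf{i},\mathbf{j}\in[q]^r_\to$. -}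

module Defs where

open import Data.Nat using (ℕ; zero; suc)
open import Data.Fin using (Fin; zero; suc; _<_; _≟_)
open import Data.Fin.Properties using (all?)
open import Data.Integer using (ℤ; _+_; 0ℤ)
open import Data.List using (List; []; _∷_; map; concatMap)
open import Data.List.Base using (allFin)
open import Relation.Nullary using (Dec; yes; no)
open import Relation.Binary.PropositionalEquality using (_≡_)

Tuple : ℕ → ℕ → Set
Tuple q n = Fin q → Fin n

-- Tensor C : [n]^q → ℤ, i.e. an element of T^{n·1_q}(ℤ).
Tensor : ℕ → ℕ → Set
Tensor q n = Tuple q n → ℤ

cons : ∀ {q n} → Fin n → Tuple q n → Tuple (suc q) n
cons x f zero    = x
cons x f (suc i) = f i

allTuples : (q n : ℕ) → List (Tuple q n)
allTuples zero    n = (λ ()) ∷ []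
allTuples (suc q) n = concatMap (λ x → map (cons x) (allTuples q n)) (allFin n)

restrict : ∀ {q r n} → Tuple q n → (Fin r → Fin q) → Tuple r n
restrict b i t = b (i t)

agrees? : ∀ {q r n} (b : Tuple q n) (i : Fin r → Fin q) (a : Tuple r n) →
          Dec (∀ t → restrict b i t ≡ a t)
agrees? b i a = all? (λ t → restrict b i t ≟ a t)

sumAgreeing : ∀ {q r n} → Tensor q n → (Fin r → Fin q) → Tuple r n →
              List (Tuple q n) → ℤ
sumAgreeing C i a []       = 0ℤ
sumAgreeing C i a (b ∷ bs) with agrees? b i a
... | yes _ = C b + sumAgreeing C i a bs
... | no  _ = sumAgreeing C i a bs

proj : ∀ {q r n} → (Fin r → Fin q) → Tensor q n → Tensor r n
proj {q} {r} {n} i C a = sumAgreeing C i a (allTuples q n)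

StrictlyIncreasing : ∀ {q r} → (Fin r → Fin q) → Set
StrictlyIncreasing {q} {r} i = ∀ (s t : Fin r) → s < t → i s < i t

IsCrystal : ∀ {q n} → (r : ℕ) → Tensor q n → Set
IsCrystal {q} {n} r C =
  ∀ (i j : Fin r → Fin q) → StrictlyIncreasing i → StrictlyIncreasing j →
  ∀ (a : Tuple r n) → proj i C a ≡ proj j C a

{-# OPTIONS --safe #-}
-- The proof steps down from k + 1 to k while k + 1 < q, using functoriality of projection,
-- Π_σ * (Π_I * C) = Π_{I ∘ σ} * C.  A strictly increasing k-tuple i misses a coordinate, so
-- i = I ∘ punchIn p for a strictly increasing (k + 1)-tuple I, and the (k + 1)-crystal condition
-- replaces I by the initial segment I₀ = (0, …, k).  Deleting entry p from I₀ is the same as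
-- deleting entry k from the increasing (k + 1)-tuple (0, …, k + 1) ∘ punchIn p, so a second use
-- of the crystal condition removes the dependence on p; this is where k + 1 < q is needed.
module Submission where

open import Defs
open import Data.Bool using (Bool; true; false; if_then_else_; _∧_)
open import Data.Fin using (Fin; zero; suc; _≟_; toℕ; punchIn; inject₁; inject≤; fromℕ)
import Data.Fin as Fin
open import Data.Fin.Properties using (all?; toℕ-inject≤; toℕ-inject₁)
open import Data.Integer using (ℤ; 0ℤ; _+_)
open import Data.Integer.Properties using (+-identityˡ; +-identityʳ; +-assoc; +-commutativeSemigroup)
open import Data.List using (List; []; _∷_; map; concatMap; _++_; allFin)
open import Data.List.Properties using (map-tabulate)
open import Data.Nat using (ℕ; _≤_; _<_; _≤′_; ≤′-refl; ≤′-step; z≤n; s≤s; s≤s⁻¹)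
open import Data.Nat.Properties using (≤-<-trans; <⇒≤; ≤⇒≤′)
open import Data.Product using (∃₂; _×_; _,_)
open import Function using (id; _∘_; mk⇔)
open import Algebra.Properties.CommutativeSemigroup +-commutativeSemigroup using (interchange)
open import Relation.Nullary using (does; yes; no)
open import Relation.Nullary.Decidable using (does-⇔)
open import Relation.Binary.PropositionalEquality
  using (_≡_; refl; sym; trans; cong; cong₂; subst₂; _≗_; module ≡-Reasoning)

private
  variable
    A B : Set
    h k m n q r : ℕ

sumOver : List A → (A → ℤ) → ℤ
sumOver []       f = 0ℤ
sumOver (x ∷ xs) f = f x + sumOver xs f

sumOver-cong : (xs : List A) {f g : A → ℤ} → f ≗ g → sumOver xs f ≡ sumOver xs g
sumOver-cong []       f≗g = refl
sumOver-cong (x ∷ xs) f≗g = cong₂ _+_ (f≗g x) (sumOver-cong xs f≗g)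

sumOver-zero : (xs : List A) → sumOver xs (λ _ → 0ℤ) ≡ 0ℤ
sumOver-zero []       = refl
sumOver-zero (x ∷ xs) = trans (+-identityˡ _) (sumOver-zero xs)

sumOver-++ : (xs ys : List A) (f : A → ℤ) → sumOver (xs ++ ys) f ≡ sumOver xs f + sumOver ys f
sumOver-++ []       ys f = sym (+-identityˡ _)
sumOver-++ (x ∷ xs) ys f = trans (cong (f x +_) (sumOver-++ xs ys f)) (sym (+-assoc (f x) _ _))

sumOver-map : (g : A → B) (xs : List A) (f : B → ℤ) → sumOver (map g xs) f ≡ sumOver xs (f ∘ g)
sumOver-map g []       f = refl
sumOver-map g (x ∷ xs) f = cong (f (g x) +_) (sumOver-map g xs f)

sumOver-concatMap : (g : A → List B) (xs : List A) (f : B → ℤ) →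
                    sumOver (concatMap g xs) f ≡ sumOver xs (λ x → sumOver (g x) f)
sumOver-concatMap g []       f = refl
sumOver-concatMap g (x ∷ xs) f =
  trans (sumOver-++ (g x) (concatMap g xs) f) (cong (sumOver (g x) f +_) (sumOver-concatMap g xs f))

sumOver-+ : (xs : List A) (f g : A → ℤ) → sumOver xs (λ x → f x + g x) ≡ sumOver xs f + sumOver xs g
sumOver-+ []       f g = refl
sumOver-+ (x ∷ xs) f g = trans (cong (f x + g x +_) (sumOver-+ xs f g)) (interchange (f x) (g x) _ _)

sumOver-swap : (xs : List A) (ys : List B) (f : A → B → ℤ) →
               sumOver xs (λ x → sumOver ys (f x)) ≡ sumOver ys (λ y → sumOver xs (λ x → f x y))
sumOver-swap []       ys f = sym (sumOver-zero ys)
sumOver-swap (x ∷ xs) ys f =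
  trans (cong (sumOver ys (f x) +_) (sumOver-swap xs ys f)) (sym (sumOver-+ ys (f x) _))

sumOver-allFin-suc : (f : Fin (ℕ.suc n) → ℤ) →
                     sumOver (allFin (ℕ.suc n)) f ≡ f zero + sumOver (allFin n) (f ∘ suc)
sumOver-allFin-suc {n} f =
  cong (f zero +_) (trans (cong (λ xs → sumOver xs f) (sym (map-tabulate id suc)))
                          (sumOver-map suc (allFin n) f))

keepIf : Bool → ℤ → ℤ
keepIf b v = if b then v else 0ℤ

keepIf-∧ : ∀ b c v → keepIf (b ∧ c) v ≡ keepIf b (keepIf c v)
keepIf-∧ true  c v = refl
keepIf-∧ false c v = refl

keepIf-comm : ∀ b c v → keepIf b (keepIf c v) ≡ keepIf c (keepIf b v)
keepIf-comm true  c     v = refl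
keepIf-comm false true  v = refl
keepIf-comm false false v = refl

keepIf-sumOver : ∀ b (xs : List A) (f : A → ℤ) → keepIf b (sumOver xs f) ≡ sumOver xs (keepIf b ∘ f)
keepIf-sumOver true  xs f = refl
keepIf-sumOver false xs f = sym (sumOver-zero xs)

sumOver-allFin-delta : (y : Fin n) (f : Fin n → ℤ) →
                       sumOver (allFin n) (λ x → keepIf (does (y ≟ x)) (f x)) ≡ f y
sumOver-allFin-delta {ℕ.suc n} zero f =
  trans (sumOver-allFin-suc (λ x → keepIf (does (zero ≟ x)) (f x)))
        (trans (cong (f zero +_) (sumOver-zero (allFin n))) (+-identityʳ (f zero)))
sumOver-allFin-delta {ℕ.suc n} (suc y) f =
  trans (sumOver-allFin-suc (λ x → keepIf (does (suc y ≟ x)) (f x)))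
        (trans (+-identityˡ _) (sumOver-allFin-delta y (f ∘ suc)))

RespectsPointwise : (Tuple k n → ℤ) → Set
RespectsPointwise g = ∀ {c c′} → c ≗ c′ → g c ≡ g c′

sumOver-allTuples-delta : (t : Tuple k n) (g : Tuple k n → ℤ) → RespectsPointwise g →
  sumOver (allTuples k n) (λ c → keepIf (does (all? (λ s → t s ≟ c s))) (g c)) ≡ g t
sumOver-allTuples-delta {ℕ.zero}  t g resp = trans (+-identityʳ _) (resp (λ ()))
sumOver-allTuples-delta {ℕ.suc k} {n} t g resp = begin
  sumOver (concatMap (λ x → map (cons x) tuples) (allFin n)) weighted
    ≡⟨ sumOver-concatMap _ (allFin n) weighted ⟩
  sumOver (allFin n) (λ x → sumOver (map (cons x) tuples) weighted)
    ≡⟨ sumOver-cong (allFin n) headFixed ⟩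
  sumOver (allFin n) (λ x → keepIf (does (t zero ≟ x)) (g (cons x (t ∘ suc))))
    ≡⟨ sumOver-allFin-delta (t zero) _ ⟩
  g (cons (t zero) (t ∘ suc))
    ≡⟨ resp (λ { zero → refl ; (suc s) → refl }) ⟩
  g t ∎
  where
  open ≡-Reasoning
  tuples = allTuples k n
  weighted = λ c → keepIf (does (all? (λ s → t s ≟ c s))) (g c)
  headFixed : ∀ x → sumOver (map (cons x) tuples) weighted ≡
                    keepIf (does (t zero ≟ x)) (g (cons x (t ∘ suc)))
  headFixed x = begin
    sumOver (map (cons x) tuples) weighted
      ≡⟨ sumOver-map (cons x) tuples weighted ⟩
    -- the Boolean part of all? over Fin (suc k) computes to the head test ∧ the tail test
    sumOver tuples (λ c → keepIf (does (t zero ≟ x) ∧ _) (g (cons x c)))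
      ≡⟨ sumOver-cong tuples (λ c → keepIf-∧ (does (t zero ≟ x)) _ (g (cons x c))) ⟩
    sumOver tuples (λ c → keepIf (does (t zero ≟ x)) _)
      ≡⟨ keepIf-sumOver (does (t zero ≟ x)) tuples _ ⟨
    keepIf (does (t zero ≟ x)) (sumOver tuples _)
      ≡⟨ cong (keepIf _) (sumOver-allTuples-delta (t ∘ suc) (g ∘ cons x)
                            (λ e → resp (λ { zero → refl ; (suc s) → e s }))) ⟩
    keepIf (does (t zero ≟ x)) (g (cons x (t ∘ suc))) ∎

agrees?-cong : {b b′ : Tuple q n} {i i′ : Fin r → Fin q} {a a′ : Tuple r n} →
               b ≗ b′ → i ≗ i′ → a ≗ a′ → does (agrees? b i a) ≡ does (agrees? b′ i′ a′)
agrees?-cong {b = b} {b′} {i} {i′} {a} {a′} b≗b′ i≗i′ a≗a′ =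
  does-⇔ (mk⇔ to from) (agrees? b i a) (agrees? b′ i′ a′)
  where
  to : (∀ t → b (i t) ≡ a t) → ∀ t → b′ (i′ t) ≡ a′ t
  to e t = trans (sym (trans (b≗b′ (i t)) (cong b′ (i≗i′ t)))) (trans (e t) (a≗a′ t))
  from : (∀ t → b′ (i′ t) ≡ a′ t) → ∀ t → b (i t) ≡ a t
  from e t = trans (trans (b≗b′ (i t)) (cong b′ (i≗i′ t))) (trans (e t) (sym (a≗a′ t)))

sumAgreeing≡sumOver : (C : Tensor q n) (i : Fin r → Fin q) (a : Tuple r n) (bs : List (Tuple q n)) →
                      sumAgreeing C i a bs ≡ sumOver bs (λ b → keepIf (does (agrees? b i a)) (C b))
sumAgreeing≡sumOver C i a []       = refl
sumAgreeing≡sumOver C i a (b ∷ bs) with agrees? b i a in eq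
... | yes _ = cong₂ _+_ (cong (λ d → keepIf (does d) (C b)) (sym eq))
                        (sumAgreeing≡sumOver C i a bs)
... | no  _ = trans (sym (+-identityˡ _))
                    (cong₂ _+_ (cong (λ d → keepIf (does d) (C b)) (sym eq))
                               (sumAgreeing≡sumOver C i a bs))

proj≡sumOver : (i : Fin r → Fin q) (C : Tensor q n) (a : Tuple r n) →
               proj i C a ≡ sumOver (allTuples q n) (λ b → keepIf (does (agrees? b i a)) (C b))
proj≡sumOver {q = q} {n} i C a = sumAgreeing≡sumOver C i a (allTuples q n)

proj-cong : {i i′ : Fin r → Fin q} {C C′ : Tensor q n} → i ≗ i′ → C ≗ C′ → ∀ a →
            proj i C a ≡ proj i′ C′ a
proj-cong {q = q} {n} {i} {i′} {C} {C′} i≗i′ C≗C′ a =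
  trans (proj≡sumOver i C a)
    (trans (sumOver-cong (allTuples q n)
              (λ b → cong₂ keepIf (agrees?-cong {b = b} {i = i} {a = a} (λ _ → refl) i≗i′ (λ _ → refl))
                                  (C≗C′ b)))
           (sym (proj≡sumOver i′ C′ a)))

proj-∘ : (I : Fin k → Fin q) (σ : Fin m → Fin k) (C : Tensor q n) →
         proj (I ∘ σ) C ≗ proj σ (proj I C)
proj-∘ {k} {q} {n = n} I σ C a = sym (begin
  proj σ (proj I C) a
    ≡⟨ proj≡sumOver σ (proj I C) a ⟩
  sumOver Tk (λ c → keepIf (σ-agrees c) (proj I C c))
    ≡⟨ sumOver-cong Tk (λ c → cong (keepIf (σ-agrees c)) (proj≡sumOver I C c)) ⟩
  sumOver Tk (λ c → keepIf (σ-agrees c) (sumOver Tq (λ b → keepIf (I-agrees b c) (C b))))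
    ≡⟨ sumOver-cong Tk (λ c → keepIf-sumOver (σ-agrees c) Tq _) ⟩
  sumOver Tk (λ c → sumOver Tq (λ b → keepIf (σ-agrees c) (keepIf (I-agrees b c) (C b))))
    ≡⟨ sumOver-swap Tk Tq _ ⟩
  sumOver Tq (λ b → sumOver Tk (λ c → keepIf (σ-agrees c) (keepIf (I-agrees b c) (C b))))
    ≡⟨ sumOver-cong Tq (λ b → sumOver-cong Tk (λ c → keepIf-comm (σ-agrees c) (I-agrees b c) (C b))) ⟩
  sumOver Tq (λ b → sumOver Tk (λ c → keepIf (I-agrees b c) (keepIf (σ-agrees c) (C b))))
    ≡⟨ sumOver-cong Tq (λ b → sumOver-allTuples-delta (b ∘ I) (λ c → keepIf (σ-agrees c) (C b))
                                 (λ c≗c′ → cong (λ w → keepIf w (C b)) (σ-agrees-cong c≗c′))) ⟩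
  sumOver Tq (λ b → keepIf (does (agrees? b (I ∘ σ) a)) (C b))
    ≡⟨ proj≡sumOver (I ∘ σ) C a ⟨
  proj (I ∘ σ) C a ∎)
  where
  open ≡-Reasoning
  Tk = allTuples k n
  Tq = allTuples q n
  σ-agrees : Tuple k n → Bool
  σ-agrees c = does (agrees? c σ a)
  σ-agrees-cong : ∀ {c c′} → c ≗ c′ → σ-agrees c ≡ σ-agrees c′
  σ-agrees-cong {c} {c′} c≗c′ = agrees?-cong {b = c} {c′} {σ} {σ} {a} {a} c≗c′ (λ _ → refl) (λ _ → refl)
  I-agrees : Tuple q n → Tuple k n → Bool
  I-agrees b c = does (agrees? b I c)

∘-increasing : {I : Fin k → Fin q} {σ : Fin m → Fin k} →
               StrictlyIncreasing I → StrictlyIncreasing σ → StrictlyIncreasing (I ∘ σ)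
∘-increasing {σ = σ} incI incσ s t s<t = incI (σ s) (σ t) (incσ s t s<t)

suc-increasing : {f : Fin m → Fin q} → StrictlyIncreasing f → StrictlyIncreasing (suc ∘ f)
suc-increasing inc s t s<t = s≤s (inc s t s<t)

cons-increasing : {x : Fin q} {f : Fin m → Fin q} →
                  (∀ t → x Fin.< f t) → StrictlyIncreasing f → StrictlyIncreasing (cons x f)
cons-increasing x<f inc zero    (suc t) _   = x<f t
cons-increasing x<f inc (suc s) (suc t) s<t = inc s t (s≤s⁻¹ s<t)

punchIn-increasing : (p : Fin (ℕ.suc m)) → StrictlyIncreasing (punchIn p)
punchIn-increasing zero    s       t       s<t = s≤s s<t
punchIn-increasing (suc p) zero    (suc t) _   = s≤s z≤n
punchIn-increasing (suc p) (suc s) (suc t) s<t = s≤s (punchIn-increasing p s t (s≤s⁻¹ s<t))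

inject₁-increasing : StrictlyIncreasing (inject₁ {m})
inject₁-increasing s t = subst₂ _<_ (sym (toℕ-inject₁ s)) (sym (toℕ-inject₁ t))

inject≤-increasing : (m≤q : m ≤ q) → StrictlyIncreasing (λ x → inject≤ x m≤q)
inject≤-increasing m≤q s t = subst₂ _<_ (sym (toℕ-inject≤ s m≤q)) (sym (toℕ-inject≤ t m≤q))

punchIn-fromℕ : (t : Fin m) → punchIn (fromℕ m) t ≡ inject₁ t
punchIn-fromℕ zero    = refl
punchIn-fromℕ (suc t) = cong suc (punchIn-fromℕ t)

punchIn-inject₁ : (p : Fin (ℕ.suc m)) (t : Fin m) →
                  punchIn (inject₁ p) (inject₁ t) ≡ inject₁ (punchIn p t)
punchIn-inject₁ zero    t       = refl
punchIn-inject₁ (suc p) zero    = refl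
punchIn-inject₁ (suc p) (suc t) = cong suc (punchIn-inject₁ p t)

predᶠ : (x : Fin (ℕ.suc q)) → 0 < toℕ x → Fin q
predᶠ (suc y) _ = y

suc-predᶠ : (x : Fin (ℕ.suc q)) (0<x : 0 < toℕ x) → suc (predᶠ x 0<x) ≡ x
suc-predᶠ (suc y) _ = refl

module _ {i : Fin (ℕ.suc m) → Fin (ℕ.suc q)} (inc : StrictlyIncreasing i) where

  tail-positive : ∀ t → 0 < toℕ (i (suc t))
  tail-positive t = ≤-<-trans z≤n (inc zero (suc t) (s≤s z≤n))

  lowerTail : Fin m → Fin q
  lowerTail t = predᶠ (i (suc t)) (tail-positive t)

  suc-lowerTail : suc ∘ lowerTail ≗ i ∘ suc
  suc-lowerTail t = suc-predᶠ (i (suc t)) (tail-positive t)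

  lowerTail-increasing : StrictlyIncreasing lowerTail
  lowerTail-increasing s t s<t =
    s≤s⁻¹ (subst₂ Fin._<_ (sym (suc-lowerTail s)) (sym (suc-lowerTail t))
                  (inc (suc s) (suc t) (s≤s s<t)))

extend-increasing : m < q → (i : Fin m → Fin q) → StrictlyIncreasing i →
  ∃₂ λ (I : Fin (ℕ.suc m) → Fin q) (p : Fin (ℕ.suc m)) → StrictlyIncreasing I × I ∘ punchIn p ≗ i
extend-increasing {ℕ.zero} {ℕ.suc q} _ i _ = (λ _ → zero) , zero , (λ { zero zero () }) , (λ ())
extend-increasing {ℕ.suc m} {ℕ.suc q} m<q i inc with i zero in i₀≡
... | suc _ = cons zero i , zero , cons-increasing positive inc , (λ _ → refl)
  where
  positive : ∀ t → 0 < toℕ (i t)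
  positive zero    rewrite i₀≡ = s≤s z≤n
  positive (suc t) = tail-positive inc t
... | zero with extend-increasing (s≤s⁻¹ m<q) (lowerTail inc) (lowerTail-increasing inc)
...   | I , p , incI , I∘punchIn≗ =
  cons zero (suc ∘ I) , suc p , cons-increasing (λ _ → s≤s z≤n) (suc-increasing incI) , extends
  where
  extends : cons zero (suc ∘ I) ∘ punchIn (suc p) ≗ i
  extends zero    = sym i₀≡
  extends (suc t) = trans (cong suc (I∘punchIn≗ t)) (suc-lowerTail inc t)

crystal-proj-∘ : {C : Tensor q n} → IsCrystal k C →
                 {I J : Fin k → Fin q} → StrictlyIncreasing I → StrictlyIncreasing J →
                 (σ : Fin m → Fin k) → proj (I ∘ σ) C ≗ proj (J ∘ σ) C
crystal-proj-∘ {C = C} crystal {I} {J} incI incJ σ a =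
  trans (proj-∘ I σ C a)
        (trans (proj-cong (λ _ → refl) (crystal I J incI incJ) a) (sym (proj-∘ J σ C a)))

crystal-pred : {C : Tensor q n} → ℕ.suc k < q → IsCrystal (ℕ.suc k) C → IsCrystal k C
crystal-pred {q} {k = k} {C} k+1<q crystal i j inc-i inc-j a =
  trans (≡initialDeleted i inc-i) (sym (≡initialDeleted j inc-j))
  where
  open ≡-Reasoning
  J : Fin (ℕ.suc (ℕ.suc k)) → Fin q
  J x = inject≤ x k+1<q
  I₀ : Fin (ℕ.suc k) → Fin q
  I₀ = J ∘ inject₁
  incJ : StrictlyIncreasing J
  incJ = inject≤-increasing k+1<q
  incI₀ : StrictlyIncreasing I₀
  incI₀ = ∘-increasing incJ inject₁-increasing
  deleted≡lastDeleted : ∀ p → proj (I₀ ∘ punchIn p) C a ≡ proj (I₀ ∘ punchIn (fromℕ k)) C a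
  deleted≡lastDeleted p = begin
    proj (I₀ ∘ punchIn p) C a
      ≡⟨ proj-cong (λ t → cong J (trans (sym (punchIn-inject₁ p t))
                                         (cong (punchIn (inject₁ p)) (sym (punchIn-fromℕ t)))))
                   (λ _ → refl) a ⟩
    proj ((J ∘ punchIn (inject₁ p)) ∘ punchIn (fromℕ k)) C a
      ≡⟨ crystal-proj-∘ crystal (∘-increasing incJ (punchIn-increasing (inject₁ p))) incI₀
                        (punchIn (fromℕ k)) a ⟩
    proj (I₀ ∘ punchIn (fromℕ k)) C a ∎
  ≡initialDeleted : (i : Fin k → Fin q) → StrictlyIncreasing i →
                    proj i C a ≡ proj (I₀ ∘ punchIn (fromℕ k)) C a
  ≡initialDeleted i inc with extend-increasing (<⇒≤ k+1<q) i inc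
  ... | I , p , incI , I∘punchIn≗i = begin
    proj i C a                        ≡⟨ proj-cong (sym ∘ I∘punchIn≗i) (λ _ → refl) a ⟩
    proj (I ∘ punchIn p) C a          ≡⟨ crystal-proj-∘ crystal incI incI₀ (punchIn p) a ⟩
    proj (I₀ ∘ punchIn p) C a         ≡⟨ deleted≡lastDeleted p ⟩
    proj (I₀ ∘ punchIn (fromℕ k)) C a ∎

crystal-descend : {C : Tensor q n} → h ≤′ k → k < q → IsCrystal k C → IsCrystal h C
crystal-descend ≤′-refl        _     crystal = crystal
crystal-descend (≤′-step h≤′k) k+1<q crystal =
  crystal-descend h≤′k (<⇒≤ k+1<q) (crystal-pred k+1<q crystal)

proposition5p5 : (q n : ℕ) → 1 ≤ q → 1 ≤ n → (h k : ℕ) → h ≤ k → k < q →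
    (C : Tensor q n) → IsCrystal k C → IsCrystal h C
proposition5p5 q n _ _ h k h≤k k<q C = crystal-descend (≤⇒≤′ h≤k) k<q
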